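{- Let $H$ be a graph and $e$ an edge of $H$, and let $G$ be the graph obtained by gluing $k$ copies of $H$ along the edge $e$ (taking $k$ disjoint copies of $H$ and identifying the copies of $e$, endpoint by endpoint). Then \[\nu(G)=(\nu(H)+1)^k-1=(\nu(H)+1)^{\frac{|V(G)|-2}{|V(H)|-2}}-1,\] where $\nu(\cdot)$ denotes the number of NAC-colourings divided by $2$.
   Context: A NAC-colouring of a graph $G$ is a surjective map $c\colon E(G)\to\{\mathrm{red},\mathrm{blue}\}$ such that every cycle of $G$ is either monochromatic or contains at least two red and at least two blue edges. -}

module Defs where

open import Data.Nat using (ℕ; zero; suc; _+_; _≤_)
open import Data.Fin using (Fin; zero; suc; inject₁)
open import Data.Bool using (Bool; true; false)
open import Data.Vec using (Vec; lookup)
open import Data.List using (List; length)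
open import Data.List.Membership.Propositional using (_∈_)
open import Data.List.Relation.Unary.Unique.Propositional using (Unique)
open import Data.Product using (Σ; ∃; ∃-syntax; _×_)
open import Data.Sum using (_⊎_)
open import Relation.Binary.PropositionalEquality using (_≡_; _≢_)

record Graph : Set where
  field
    n : ℕ
    m : ℕ
    src : Fin m → Fin n
    tgt : Fin m → Fin n
    loopless : ∀ f → src f ≢ tgt f

  Joins : Fin m → Fin n → Fin n → Set
  Joins f u v = (src f ≡ u × tgt f ≡ v) ⊎ (src f ≡ v × tgt f ≡ u)

  field
    simple : ∀ f g → Joins g (src f) (tgt f) → f ≡ g

open Graph public

record Cycle (G : Graph) : Set where
  field
    len : ℕ
    len≥3 : 3 ≤ len
    vs : Fin (suc len) → Fin (n G)
    es : Fin len → Fin (m G)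
    joins : ∀ i → Joins G (es i) (vs (inject₁ i)) (vs (suc i))
    closed : vs (Data.Fin.fromℕ len) ≡ vs zero
    distinct : ∀ i j → vs (inject₁ i) ≡ vs (inject₁ j) → i ≡ j

open Cycle public

-- Edge colourings: true = red, false = blue.
Colouring : Graph → Set
Colouring G = Vec Bool (m G)

countB : ∀ {l} → Bool → (Fin l → Bool) → ℕ
countB {zero} b f = 0
countB {suc l} true f with f zero
... | true = suc (countB true (λ i → f (suc i)))
... | false = countB true (λ i → f (suc i))
countB {suc l} false f with f zero
... | true = countB false (λ i → f (suc i))
... | false = suc (countB false (λ i → f (suc i)))

module _ {G : Graph} (c : Colouring G) (C : Cycle G) where
  cycCol : Fin (len C) → Bool
  cycCol i = lookup c (es C i)

  Monochromatic : Set
  Monochromatic = ∀ i j → cycCol i ≡ cycCol j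

  TwoRedTwoBlue : Set
  TwoRedTwoBlue = (2 ≤ countB true cycCol) × (2 ≤ countB false cycCol)

IsNAC : (G : Graph) → Colouring G → Set
IsNAC G c =
  (∃[ f ] lookup c f ≡ true) × (∃[ f ] lookup c f ≡ false) ×
  (∀ (C : Cycle G) → Monochromatic c C ⊎ TwoRedTwoBlue c C)

NACCount : Graph → ℕ → Set
NACCount G N = Σ (List (Colouring G)) λ L →
  Unique L × (∀ c → c ∈ L → IsNAC G c) × (∀ c → IsNAC G c → c ∈ L) × length L ≡ N

-- G is (isomorphic to) the graph obtained by gluing k copies of H along
-- the edge e: copy maps φ i (vertices) and ψ i (edges), i < k.
record IsGluing (H : Graph) (e : Fin (m H)) (k : ℕ) (G : Graph) : Set where
  field
    φ : Fin k → Fin (n H) → Fin (n G)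
    ψ : Fin k → Fin (m H) → Fin (m G)
    ψ-hom : ∀ i f → Joins G (ψ i f) (φ i (src H f)) (φ i (tgt H f))
    φ-glue-src : ∀ i j → φ i (src H e) ≡ φ j (src H e)
    φ-glue-tgt : ∀ i j → φ i (tgt H e) ≡ φ j (tgt H e)
    ψ-glue : ∀ i j → ψ i e ≡ ψ j e
    φ-inj : ∀ i j u v → φ i u ≡ φ j v →
      u ≡ v × (i ≡ j ⊎ u ≡ src H e ⊎ u ≡ tgt H e)
    ψ-inj : ∀ i j f g → ψ i f ≡ ψ j g → f ≡ g × (i ≡ j ⊎ f ≡ e)
    φ-surj : ∀ w → ∃[ i ] ∃[ u ] φ i u ≡ w
    ψ-surj : ∀ g → ∃[ i ] ∃[ f ] ψ i f ≡ g

-- A colouring satisfies the cycle condition iff no edge f has a bypass: a walk between the ends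
-- of f using only edges of the other colour (shortened to a path, it would close a cycle with
-- exactly one edge of the colour of f). Having no bypass can be checked copy by copy: a
-- monochromatic walk in G between two vertices of copy i can be rerouted inside copy i, because
-- whenever it runs through another copy from one end of e to the other, e itself must have that
-- colour (otherwise that stretch is a bypass of e in that copy). Fixing e red, the bypass-free
-- colourings of G are thus exactly the k-tuples of bypass-free colourings of H with e red. Those of
-- H number ν(H) + 1, the extra one being the all-red colouring, the only bypass-free colouring with
-- e red that is not surjective; and complementation shows that exactly half of all NAC-colourings
-- have e red.
module Submission where

open import Defs
open import Data.Bool using (Bool; true; false; not)
open import Data.Bool.Properties using (not-¬; ¬-not; not-involutive; not-injective)
import Data.Bool.Properties as Bool
open import Data.Empty using (⊥; ⊥-elim)
open import Data.Fin using (Fin; zero; suc; inject₁; fromℕ; fromℕ<)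
open import Data.Fin.Properties using (any?; fromℕ≢inject₁; inject₁-injective)
  renaming (_≟_ to _≟ᶠ_; suc-injective to Fin-suc-injective)
open import Data.List using (List; []; _∷_; _++_; filter; cartesianProduct; allFin)
import Data.List as List
open import Data.List.Properties using (length-map; length-++; length-tabulate)
open import Data.List.Membership.Propositional using (_∈_)
open import Data.List.Membership.Propositional.Properties
  using (∈-map⁺; ∈-map⁻; ∈-++⁺ˡ; ∈-++⁺ʳ; ∈-++⁻; ∈-filter⁺; ∈-filter⁻; ∈-allFin;
         ∈-cartesianProduct⁺; ∈-cartesianProduct⁻)
open import Data.List.Membership.Propositional.Properties.WithK using (unique∧set⇒bag)
open import Data.List.Relation.Binary.BagAndSetEquality using (∼bag⇒↭)
open import Data.List.Relation.Binary.Permutation.Propositional.Properties using (↭-length)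
open import Data.List.Relation.Unary.All as All using (All; []; _∷_)
open import Data.List.Relation.Unary.Any using (here)
open import Data.List.Relation.Unary.AllPairs using ([]; _∷_)
open import Data.List.Relation.Unary.Unique.Propositional using (Unique)
open import Data.List.Relation.Unary.Unique.Propositional.Properties
  using (++⁺; filter⁺; allFin⁺; cartesianProduct⁺)
open import Data.Nat using (ℕ; zero; suc; _+_; _*_; _∸_; _^_; _/_; _≤_; _≤?_; z≤n; s≤s)
open import Data.Nat.DivMod using (m*n/n≡m)
open import Data.Nat.Properties using (m+n∸n≡m; ∸-+-assoc; +-identityʳ; *-comm; suc-injective; 1+n≰n)
open import Data.Product using (Σ; ∃-syntax; _×_; _,_; proj₁; proj₂; uncurry)
open import Data.Sum using (_⊎_; inj₁; inj₂; [_,_])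
open import Data.Unit using (tt)
open import Data.Vec using (Vec; []; _∷_; lookup; tabulate; replicate)
open import Data.Vec.Properties
  using (∷-injective; lookup∘tabulate; tabulate∘lookup; tabulate-cong; lookup-map; lookup-replicate;
         map-∘; map-cong; map-id; ≡-dec)
import Data.Vec as Vec
import Data.Vec.Relation.Unary.All as VecAll
open import Data.Vec.Relation.Unary.All.Properties using (lookup⁺; tabulate⁺)
open import Function.Base using (id; _∘_)
open import Function.Bundles using (mk⇔)
open import Level using (0ℓ)
open import Relation.Binary.Construct.Closure.ReflexiveTransitive using (Star; ε; _◅_; _◅◅_; reverse)
import Relation.Binary.Construct.Closure.ReflexiveTransitive as Star
open import Relation.Binary.Core using (Rel)
open import Relation.Binary.Definitions using (DecidableEquality)
open import Relation.Binary.PropositionalEquality hiding ([_])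
open import Relation.Nullary using (¬_; yes; no; ¬?)
open import Relation.Unary using (Pred; Decidable; U; _⊆′_; _∩_; _∪_; _⟨×⟩_)

-- NACCount G N unfolds to Card (IsNAC G) N.
Card : {A : Set} → Pred A 0ℓ → ℕ → Set
Card {A} P N = Σ (List A) λ L →
  Unique L × (∀ a → a ∈ L → P a) × (∀ a → P a → a ∈ L) × List.length L ≡ N

module _ {A : Set} {P : Pred A 0ℓ} where

  Card-unique : ∀ {M N} → Card P M → Card P N → M ≡ N
  Card-unique (L₁ , u₁ , sound₁ , complete₁ , refl) (L₂ , u₂ , sound₂ , complete₂ , refl) =
    ↭-length (∼bag⇒↭ (unique∧set⇒bag u₁ u₂
      (mk⇔ (λ a∈L₁ → complete₂ _ (sound₁ _ a∈L₁)) (λ a∈L₂ → complete₁ _ (sound₂ _ a∈L₂)))))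

  Card-cong : ∀ {Q : Pred A 0ℓ} {N} → P ⊆′ Q → Q ⊆′ P → Card P N → Card Q N
  Card-cong to from (L , u , sound , complete , len) =
    L , u , (λ a a∈L → to a (sound a a∈L)) , (λ a q → complete a (from a q)) , len

  Card-filter : ∀ {Q : Pred A 0ℓ} {N} → Decidable Q → Card P N → ∃[ K ] Card (P ∩ Q) K
  Card-filter Q? (L , u , sound , complete , _) =
    List.length (filter Q? L) , filter Q? L , filter⁺ Q? u ,
    (λ a m → let a∈L , q = ∈-filter⁻ Q? m in sound a a∈L , q) ,
    (λ a (p , q) → ∈-filter⁺ Q? (complete a p) q) , refl

Card-singleton : ∀ {A : Set} (a : A) → Card (_≡ a) 1
Card-singleton a = a ∷ [] , [] ∷ [] , (λ { _ (here refl) → refl }) , (λ { _ refl → here refl }) , refl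

Card-∪ : ∀ {A : Set} {P Q : Pred A 0ℓ} {M N} → (∀ a → P a → Q a → ⊥) →
  Card P M → Card Q N → Card (P ∪ Q) (M + N)
Card-∪ disjoint (L₁ , u₁ , sound₁ , complete₁ , len₁) (L₂ , u₂ , sound₂ , complete₂ , len₂) =
  L₁ ++ L₂ , ++⁺ u₁ u₂ (λ (m₁ , m₂) → disjoint _ (sound₁ _ m₁) (sound₂ _ m₂)) ,
  (λ a m → [ (λ m₁ → inj₁ (sound₁ a m₁)) , (λ m₂ → inj₂ (sound₂ a m₂)) ] (∈-++⁻ L₁ m)) ,
  (λ a → [ (λ p → ∈-++⁺ˡ (complete₁ a p)) , (λ q → ∈-++⁺ʳ L₁ (complete₂ a q)) ]) ,
  trans (length-++ L₁) (cong₂ _+_ len₁ len₂)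

Card-remove : ∀ {A : Set} {P : Pred A 0ℓ} {N} → DecidableEquality A → ∀ {a} → P a → Card P N →
  Card (P ∩ (_≢ a)) (N ∸ 1)
Card-remove {P = P} {N} _≟_ {a} pa card with Card-filter (λ b → ¬? (b ≟ a)) card
... | K , card′ = subst (Card (P ∩ (_≢ a))) K≡N∸1 card′
  where
  split : P ⊆′ (P ∩ (_≢ a)) ∪ (_≡ a)
  split b pb with b ≟ a
  ... | yes b≡a = inj₂ b≡a
  ... | no b≢a = inj₁ (pb , b≢a)
  K+1≡N : K + 1 ≡ N
  K+1≡N = Card-unique
    (Card-cong (λ _ → [ proj₁ , (λ { refl → pa }) ]) split
      (Card-∪ (λ _ (_ , b≢a) → b≢a) card′ (Card-singleton a)))
    card
  K≡N∸1 : K ≡ N ∸ 1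
  K≡N∸1 = trans (sym (m+n∸n≡m K 1)) (cong (_∸ 1) K+1≡N)

module _ {A B : Set} {P : Pred A 0ℓ} {Q : Pred B 0ℓ} (f : A → B)
  (f-inj : ∀ {a a′} → P a → P a′ → f a ≡ f a′ → a ≡ a′) where

  Unique-map⁺ : ∀ {L} → All P L → Unique L → Unique (List.map f L)
  Unique-map⁺ [] [] = []
  Unique-map⁺ {a ∷ L} (pa ∷ pL) (a∉L ∷ u) =
    All.tabulate (λ m fa≡fb → let b , b∈L , fb≡ = ∈-map⁻ f m in
      All.lookup a∉L b∈L (f-inj pa (All.lookup pL b∈L) (trans fa≡fb fb≡)))
    ∷ Unique-map⁺ pL u

  Card-image : ∀ {N} → (∀ a → P a → Q (f a)) → (∀ b → Q b → ∃[ a ] P a × f a ≡ b) →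
    Card P N → Card Q N
  Card-image into onto (L , u , sound , complete , len) =
    List.map f L , Unique-map⁺ (All.tabulate (sound _)) u ,
    (λ b m → let a , a∈L , b≡fa = ∈-map⁻ f m in subst Q (sym b≡fa) (into a (sound a a∈L))) ,
    (λ b q → let a , pa , fa≡b = onto b q in subst (_∈ List.map f L) fa≡b (∈-map⁺ f (complete a pa))) ,
    trans (length-map f L) len

Card-Fin : ∀ n → Card {Fin n} U n
Card-Fin n = allFin n , allFin⁺ n , (λ _ _ → tt) , (λ a _ → ∈-allFin a) , length-tabulate (λ i → i)

Card-Fin-except-two : ∀ {n} {a b : Fin n} → a ≢ b → Card (λ v → v ≢ a × v ≢ b) (n ∸ 2)
Card-Fin-except-two {n} {a} {b} a≢b = subst (Card _) (∸-+-assoc n 1 1)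
  (Card-cong (λ _ ((_ , v≢a) , v≢b) → v≢a , v≢b) (λ _ (v≢a , v≢b) → (tt , v≢a) , v≢b)
    (Card-remove _≟ᶠ_ (tt , λ b≡a → a≢b (sym b≡a)) (Card-remove _≟ᶠ_ tt (Card-Fin n))))

length-cartesianProduct : ∀ {A B : Set} (xs : List A) (ys : List B) →
  List.length (cartesianProduct xs ys) ≡ List.length xs * List.length ys
length-cartesianProduct [] ys = refl
length-cartesianProduct (x ∷ xs) ys =
  trans (length-++ (List.map (x ,_) ys)) (cong₂ _+_ (length-map (x ,_) ys) (length-cartesianProduct xs ys))

Card-× : ∀ {A B : Set} {P : Pred A 0ℓ} {Q : Pred B 0ℓ} {M N} → Card P M → Card Q N → Card (P ⟨×⟩ Q) (M * N)
Card-× (L₁ , u₁ , sound₁ , complete₁ , len₁) (L₂ , u₂ , sound₂ , complete₂ , len₂) =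
  cartesianProduct L₁ L₂ , cartesianProduct⁺ u₁ u₂ ,
  (λ (a , b) m → let m₁ , m₂ = ∈-cartesianProduct⁻ L₁ L₂ m in sound₁ a m₁ , sound₂ b m₂) ,
  (λ (a , b) (p , q) → ∈-cartesianProduct⁺ (complete₁ a p) (complete₂ b q)) ,
  trans (length-cartesianProduct L₁ L₂) (cong₂ _*_ len₁ len₂)

Card-All : ∀ {A : Set} {P : Pred A 0ℓ} {N} → Card P N → ∀ k → Card (VecAll.All P {k}) (N ^ k)
Card-All card zero = [] ∷ [] , [] ∷ [] , (λ { [] _ → VecAll.[] }) , (λ { [] _ → here refl }) , refl
Card-All card (suc k) = Card-image (uncurry _∷_)
  (λ _ _ eq → let a≡a′ , v≡v′ = ∷-injective eq in cong₂ _,_ a≡a′ v≡v′)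
  (λ _ (pa , pv) → pa VecAll.∷ pv)
  (λ { _ (pa VecAll.∷ pv) → _ , (pa , pv) , refl })
  (Card-× card (Card-All card k))

countB-step : ∀ b {l} (g : Fin (suc l) → Bool) →
  (g zero ≡ b × countB b g ≡ suc (countB b (λ i → g (suc i)))) ⊎
  (g zero ≢ b × countB b g ≡ countB b (λ i → g (suc i)))
countB-step true g with g zero
... | true = inj₁ (refl , refl)
... | false = inj₂ ((λ ()) , refl)
countB-step false g with g zero
... | true = inj₂ ((λ ()) , refl)
... | false = inj₁ (refl , refl)

countB≡0⇒ : ∀ b {l} (g : Fin l → Bool) → countB b g ≡ 0 → ∀ i → g i ≢ b
countB≡0⇒ b {suc l} g none i with countB-step b g
countB≡0⇒ b g none i | inj₁ (_ , eq) with () ← trans (sym eq) none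
countB≡0⇒ b g none zero | inj₂ (g₀≢b , _) = g₀≢b
countB≡0⇒ b g none (suc i) | inj₂ (_ , eq) = countB≡0⇒ b (λ i → g (suc i)) (trans (sym eq) none) i

countB≡0⇐ : ∀ b {l} (g : Fin l → Bool) → (∀ i → g i ≢ b) → countB b g ≡ 0
countB≡0⇐ b {zero} g none = refl
countB≡0⇐ b {suc l} g none with countB-step b g
... | inj₁ (g₀≡b , _) = ⊥-elim (none zero g₀≡b)
... | inj₂ (_ , eq) = trans eq (countB≡0⇐ b (λ i → g (suc i)) (λ i → none (suc i)))

countB-only-head : ∀ b {l} (g : Fin (suc l) → Bool) → g zero ≡ b → (∀ i → g (suc i) ≢ b) →
  countB b g ≡ 1
countB-only-head b g g₀≡b others with countB-step b g
... | inj₁ (_ , eq) = trans eq (cong suc (countB≡0⇐ b (λ i → g (suc i)) others))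
... | inj₂ (g₀≢b , _) = ⊥-elim (g₀≢b g₀≡b)

countB≡1⇒ : ∀ b {l} (g : Fin l → Bool) → countB b g ≡ 1 →
  ∃[ i₀ ] g i₀ ≡ b × (∀ j → j ≢ i₀ → g j ≢ b)
countB≡1⇒ b {suc l} g one with countB-step b g
... | inj₁ (g₀≡b , eq) = zero , g₀≡b , λ
  { zero j≢0 → ⊥-elim (j≢0 refl)
  ; (suc j) _ → countB≡0⇒ b (λ i → g (suc i)) (suc-injective (trans (sym eq) one)) j }
... | inj₂ (g₀≢b , eq) with countB≡1⇒ b (λ i → g (suc i)) (trans (sym eq) one)
...   | i₀ , gi₀≡b , others = suc i₀ , gi₀≡b , λ
  { zero _ → g₀≢b
  ; (suc j) j≢i₀ → others j (λ j≡i₀ → j≢i₀ (cong suc j≡i₀)) }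

lookup-extensionality : ∀ {A : Set} {l} {u v : Vec A l} → (∀ i → lookup u i ≡ lookup v i) → u ≡ v
lookup-extensionality {u = u} {v} eq =
  trans (sym (tabulate∘lookup u)) (trans (tabulate-cong eq) (tabulate∘lookup v))

Coloured : ∀ {l} → Vec Bool l → Bool → Pred (Fin l) 0ℓ
Coloured c b f = lookup c f ≡ b

Red : ∀ {l} → Fin l → Pred (Vec Bool l) 0ℓ
Red f c = lookup c f ≡ true

module _ (G : Graph) where

  Joins-sym : ∀ {f u v} → Joins G f u v → Joins G f v u
  Joins-sym (inj₁ (s , t)) = inj₂ (s , t)
  Joins-sym (inj₂ (s , t)) = inj₁ (s , t)

  Joins-unique : ∀ {f u v u′ v′} → Joins G f u v → Joins G f u′ v′ →
    (u ≡ u′ × v ≡ v′) ⊎ (u ≡ v′ × v ≡ u′)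
  Joins-unique (inj₁ (refl , refl)) (inj₁ (refl , refl)) = inj₁ (refl , refl)
  Joins-unique (inj₁ (refl , refl)) (inj₂ (refl , refl)) = inj₂ (refl , refl)
  Joins-unique (inj₂ (refl , refl)) (inj₁ (refl , refl)) = inj₂ (refl , refl)
  Joins-unique (inj₂ (refl , refl)) (inj₂ (refl , refl)) = inj₁ (refl , refl)

  Joins-loopless : ∀ {f u} → ¬ Joins G f u u
  Joins-loopless (inj₁ (refl , t)) = loopless G _ (sym t)
  Joins-loopless (inj₂ (refl , t)) = loopless G _ (sym t)

  parallel⇒≡ : ∀ {f g u v} → Joins G f u v → Joins G g u v → f ≡ g
  parallel⇒≡ {f} (inj₁ (refl , refl)) j = simple G f _ j
  parallel⇒≡ {f} (inj₂ (refl , refl)) j = simple G f _ (Joins-sym j)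

  data Step (P : Pred (Fin (m G)) 0ℓ) (u v : Fin (n G)) : Set where
    step : ∀ f → P f → Joins G f u v → Step P u v

  Walk : Pred (Fin (m G)) 0ℓ → Rel (Fin (n G)) 0ℓ
  Walk P = Star (Step P)

module _ {G : Graph} {P : Pred (Fin (m G)) 0ℓ} where

  Step-sym : ∀ {u v} → Step G P u v → Step G P v u
  Step-sym (step f p j) = step f p (Joins-sym G j)

  Walk-sym : ∀ {u v} → Walk G P u v → Walk G P v u
  Walk-sym = reverse Step-sym

  Walk-edge : ∀ {f u v} → P f → Joins G f u v → Walk G P u v
  Walk-edge p j = step _ p j ◅ ε

  Walk-map : ∀ {Q : Pred (Fin (m G)) 0ℓ} → (∀ {f} → P f → Q f) → ∀ {u v} → Walk G P u v → Walk G Q u v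
  Walk-map P⇒Q = Star.map λ { (step f p j) → step f (P⇒Q p) j }

  Walk-empty : (∀ {f} → ¬ P f) → ∀ {u v} → Walk G P u v → u ≡ v
  Walk-empty _ ε = refl
  Walk-empty ¬P (step _ p _ ◅ _) = ⊥-elim (¬P p)

  reorient : ∀ {f u v u′ v′} → Joins G f u v → Joins G f u′ v′ → Walk G P v u → Walk G P v′ u′
  reorient j j′ w with Joins-unique G j j′
  ... | inj₁ (refl , refl) = w
  ... | inj₂ (refl , refl) = Walk-sym w

  length : ∀ {u v} → Walk G P u v → ℕ
  length ε = 0
  length (_ ◅ w) = suc (length w)

  vertex : ∀ {u v} (w : Walk G P u v) → Fin (suc (length w)) → Fin (n G)
  vertex {u} _ zero = u
  vertex (_ ◅ w) (suc i) = vertex w i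

  -- The suc clauses come first so that these functions compute on a walk whose first step is neutral.
  edge : ∀ {u v} (w : Walk G P u v) → Fin (length w) → Fin (m G)
  edge (_ ◅ w) (suc i) = edge w i
  edge (step f _ _ ◅ _) zero = f

  vertex-last : ∀ {u v} (w : Walk G P u v) → vertex w (fromℕ (length w)) ≡ v
  vertex-last ε = refl
  vertex-last (_ ◅ w) = vertex-last w

  edge-joins : ∀ {u v} (w : Walk G P u v) i → Joins G (edge w i) (vertex w (inject₁ i)) (vertex w (suc i))
  edge-joins (_ ◅ w) (suc i) = edge-joins w i
  edge-joins (step _ _ j ◅ _) zero = j

  edge-satisfies : ∀ {u v} (w : Walk G P u v) i → P (edge w i)
  edge-satisfies (_ ◅ w) (suc i) = edge-satisfies w i
  edge-satisfies (step _ p _ ◅ _) zero = p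

  IsPath : ∀ {u v} → Walk G P u v → Set
  IsPath w = ∀ i j → vertex w i ≡ vertex w j → i ≡ j

  Path : Rel (Fin (n G)) 0ℓ
  Path u v = Σ (Walk G P u v) IsPath

  Path-suffix : ∀ {u v} (p : Walk G P u v) → IsPath p → ∀ i → Path (vertex p i) v
  Path-suffix p p-path zero = p , p-path
  Path-suffix (_ ◅ p) p-path (suc i) =
    Path-suffix p (λ a b eq → Fin-suc-injective (p-path (suc a) (suc b) eq)) i

  shortcut : ∀ {u v} → Walk G P u v → Path u v
  shortcut ε = ε , λ { zero zero _ → refl }
  shortcut {u} (s ◅ w) with shortcut w
  ... | p , p-path with any? (λ i → vertex p i ≟ᶠ u)
  ...   | yes (i , refl) = Path-suffix p p-path i
  ...   | no u∉p = s ◅ p , s◅p-path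
    where
    s◅p-path : IsPath (s ◅ p)
    s◅p-path zero zero _ = refl
    s◅p-path zero (suc j) eq = ⊥-elim (u∉p (j , sym eq))
    s◅p-path (suc i) zero eq = ⊥-elim (u∉p (i , eq))
    s◅p-path (suc i) (suc j) eq = cong suc (p-path i j eq)

CycleCondition : (G : Graph) → Colouring G → Set
CycleCondition G c = ∀ C → Monochromatic {G} c C ⊎ TwoRedTwoBlue {G} c C

Bypass : (G : Graph) → Colouring G → Fin (m G) → Set
Bypass G c f = Walk G (Coloured c (not (lookup c f))) (tgt G f) (src G f)

NoBypass : (G : Graph) → Colouring G → Set
NoBypass G c = ∀ f → ¬ Bypass G c f

module _ {G : Graph} {P : Pred (Fin (m G)) 0ℓ} where

  cycleThrough : ∀ {f a b} → Joins G f a b → (p : Walk G P b a) → IsPath p → 2 ≤ length p → Cycle G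
  cycleThrough {f} {a} j p p-path 2≤len = record
    { len = suc (length p)
    ; len≥3 = s≤s 2≤len
    ; vs = vertices
    ; es = λ { zero → f ; (suc i) → edge p i }
    ; joins = λ { zero → j ; (suc i) → edge-joins p i }
    ; closed = vertex-last p
    ; distinct = vertices-distinct
    }
    where
    vertices : Fin (suc (suc (length p))) → Fin (n G)
    vertices zero = a
    vertices (suc i) = vertex p i
    vertices-distinct : ∀ i j → vertices (inject₁ i) ≡ vertices (inject₁ j) → i ≡ j
    vertices-distinct zero zero _ = refl
    vertices-distinct zero (suc j) eq =
      ⊥-elim (fromℕ≢inject₁ (p-path (fromℕ _) (inject₁ j) (trans (vertex-last p) eq)))
    vertices-distinct (suc i) zero eq =
      ⊥-elim (fromℕ≢inject₁ (p-path (fromℕ _) (inject₁ i) (trans (vertex-last p) (sym eq))))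
    vertices-distinct (suc i) (suc j) eq = cong suc (inject₁-injective (p-path (inject₁ i) (inject₁ j) eq))

  walkAlong : ∀ {l} (vs : Fin (suc l) → Fin (n G)) (es : Fin l → Fin (m G)) →
    (∀ i → Joins G (es i) (vs (inject₁ i)) (vs (suc i))) → (∀ i → P (es i)) →
    Walk G P (vs zero) (vs (fromℕ l))
  walkAlong {zero} vs es joins ok = ε
  walkAlong {suc l} vs es joins ok = step (es zero) (ok zero) (joins zero) ◅
    walkAlong (λ i → vs (suc i)) (λ i → es (suc i)) (λ i → joins (suc i)) (λ i → ok (suc i))

  walkBefore : ∀ {l} (vs : Fin (suc l) → Fin (n G)) (es : Fin l → Fin (m G)) →
    (∀ i → Joins G (es i) (vs (inject₁ i)) (vs (suc i))) → ∀ i₀ → (∀ i → i ≢ i₀ → P (es i)) →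
    Walk G P (vs zero) (vs (inject₁ i₀))
  walkBefore vs es joins zero ok = ε
  walkBefore vs es joins (suc i₀) ok = step (es zero) (ok zero (λ ())) (joins zero) ◅
    walkBefore (λ i → vs (suc i)) (λ i → es (suc i)) (λ i → joins (suc i)) i₀
      (λ i i≢i₀ → ok (suc i) (λ eq → i≢i₀ (Fin-suc-injective eq)))

  walkAfter : ∀ {l} (vs : Fin (suc l) → Fin (n G)) (es : Fin l → Fin (m G)) →
    (∀ i → Joins G (es i) (vs (inject₁ i)) (vs (suc i))) → ∀ i₀ → (∀ i → i ≢ i₀ → P (es i)) →
    Walk G P (vs (suc i₀)) (vs (fromℕ l))
  walkAfter vs es joins zero ok =
    walkAlong (λ i → vs (suc i)) (λ i → es (suc i)) (λ i → joins (suc i)) (λ i → ok (suc i) (λ ()))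
  walkAfter vs es joins (suc i₀) ok =
    walkAfter (λ i → vs (suc i)) (λ i → es (suc i)) (λ i → joins (suc i)) i₀
      (λ i i≢i₀ → ok (suc i) (λ eq → i≢i₀ (Fin-suc-injective eq)))

  cycle-detour : (C : Cycle G) (i₀ : Fin (len C)) → (∀ i → i ≢ i₀ → P (es C i)) →
    Walk G P (vs C (suc i₀)) (vs C (inject₁ i₀))
  cycle-detour C i₀ ok =
    walkAfter (vs C) (es C) (joins C) i₀ ok ◅◅
    subst (λ v → Walk G P v (vs C (inject₁ i₀))) (sym (closed C)) (walkBefore (vs C) (es C) (joins C) i₀ ok)

module _ {G : Graph} (c : Colouring G) where

  TwoRedTwoBlue⇒2≤countB : ∀ C b → TwoRedTwoBlue {G} c C → 2 ≤ countB b (cycCol {G} c C)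
  TwoRedTwoBlue⇒2≤countB C true (two-red , _) = two-red
  TwoRedTwoBlue⇒2≤countB C false (_ , two-blue) = two-blue

  cycleCondition⇒noBypass : CycleCondition G c → NoBypass G c
  cycleCondition⇒noBypass cc f bypass =
    let p , p-path = shortcut bypass in noPathBypass (inj₁ (refl , refl)) p p-path
    where
    noPathBypass : ∀ {a b} → Joins G f a b → (p : Walk G (Coloured c (not (lookup c f))) b a) → IsPath p → ⊥
    noPathBypass j ε _ = Joins-loopless G j
    noPathBypass j (step g g-col j′ ◅ ε) _ with parallel⇒≡ G j (Joins-sym G j′)
    ... | refl = not-¬ refl g-col
    noPathBypass j p@(_ ◅ _ ◅ _) p-path = [ monochromatic , twoRedTwoBlue ] (cc C)
      where
      C : Cycle G
      C = cycleThrough j p p-path (s≤s (s≤s z≤n))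
      other-colour : ∀ i → cycCol {G} c C (suc i) ≢ lookup c f
      other-colour i eq = not-¬ refl (trans (sym eq) (edge-satisfies p i))
      monochromatic : ¬ Monochromatic {G} c C
      monochromatic mono = other-colour zero (mono (suc zero) zero)
      twoRedTwoBlue : ¬ TwoRedTwoBlue {G} c C
      twoRedTwoBlue two = 1+n≰n (subst (2 ≤_)
        (countB-only-head (lookup c f) (cycCol {G} c C) refl other-colour)
        (TwoRedTwoBlue⇒2≤countB C (lookup c f) two))

  fewOfOneColour⇒monochromatic : NoBypass G c → ∀ C b → ¬ 2 ≤ countB b (cycCol {G} c C) →
    Monochromatic {G} c C
  fewOfOneColour⇒monochromatic nb C b few with countB b (cycCol {G} c C) in count≡
  ... | zero = λ i j → trans (¬-not (none i)) (sym (¬-not (none j)))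
    where
    none : ∀ i → cycCol {G} c C i ≢ b
    none = countB≡0⇒ b (cycCol {G} c C) count≡
  ... | suc (suc _) = ⊥-elim (few (s≤s (s≤s z≤n)))
  ... | suc zero with countB≡1⇒ b (cycCol {G} c C) count≡
  ...   | i₀ , col-i₀ , others = ⊥-elim (nb (es C i₀) (reorient (joins C i₀) (inj₁ (refl , refl)) detour))
    where
    detour : Walk G (Coloured c (not (lookup c (es C i₀)))) (vs C (suc i₀)) (vs C (inject₁ i₀))
    detour = cycle-detour C i₀ (λ i i≢i₀ → trans (¬-not (others i i≢i₀)) (cong not (sym col-i₀)))

  noBypass⇒cycleCondition : NoBypass G c → CycleCondition G c
  noBypass⇒cycleCondition nb C with 2 ≤? countB true (cycCol {G} c C) | 2 ≤? countB false (cycCol {G} c C)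
  ... | yes two-red | yes two-blue = inj₂ (two-red , two-blue)
  ... | no few-red | _ = inj₁ (fewOfOneColour⇒monochromatic nb C true few-red)
  ... | _ | no few-blue = inj₁ (fewOfOneColour⇒monochromatic nb C false few-blue)

module Gluing {H : Graph} {e : Fin (m H)} {k : ℕ} {G : Graph} (gl : IsGluing H e k G) where
  open IsGluing gl

  Joins-copy : ∀ i {f u v} → Joins H f u v → Joins G (ψ i f) (φ i u) (φ i v)
  Joins-copy i {f} (inj₁ (refl , refl)) = ψ-hom i f
  Joins-copy i {f} (inj₂ (refl , refl)) = Joins-sym G (ψ-hom i f)

  Walk-copy : ∀ i {P Q} → (∀ {f} → P f → Q (ψ i f)) → ∀ {u v} → Walk H P u v → Walk G Q (φ i u) (φ i v)
  Walk-copy i P⇒Q = Star.gmap (φ i) λ { (step f p j) → step (ψ i f) (P⇒Q p) (Joins-copy i j) }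

  restrict : Colouring G → Fin k → Colouring H
  restrict c i = tabulate λ f → lookup c (ψ i f)

  lookup-restrict : ∀ c i f → lookup (restrict c i) f ≡ lookup c (ψ i f)
  lookup-restrict c i = lookup∘tabulate (λ f → lookup c (ψ i f))

  glue : Vec (Colouring H) k → Colouring G
  glue ds = tabulate λ g → let i , f , _ = ψ-surj g in lookup (lookup ds i) f

  restrict-glue : ∀ ds → (∀ i j → lookup (lookup ds i) e ≡ lookup (lookup ds j) e) →
    ∀ i → restrict (glue ds) i ≡ lookup ds i
  restrict-glue ds agree i = lookup-extensionality λ f →
    trans (lookup-restrict (glue ds) i f) (trans (lookup∘tabulate _ (ψ i f)) (from-copy (ψ-surj (ψ i f))))
    where
    from-copy : ∀ {f} (s : ∃[ i′ ] ∃[ f′ ] ψ i′ f′ ≡ ψ i f) →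
      lookup (lookup ds (proj₁ s)) (proj₁ (proj₂ s)) ≡ lookup (lookup ds i) f
    from-copy {f} (i′ , f′ , ψ≡) with ψ-inj i′ i f′ f ψ≡
    ... | refl , inj₁ refl = refl
    ... | refl , inj₂ refl = agree i′ i

  glue-restrict : ∀ c → glue (tabulate (restrict c)) ≡ c
  glue-restrict c = lookup-extensionality λ g → trans (lookup∘tabulate _ g) (to-copy (ψ-surj g))
    where
    to-copy : ∀ {g} (s : ∃[ i ] ∃[ f ] ψ i f ≡ g) →
      lookup (lookup (tabulate (restrict c)) (proj₁ s)) (proj₁ (proj₂ s)) ≡ lookup c g
    to-copy (i , f , refl) =
      trans (cong (λ d → lookup d f) (lookup∘tabulate (restrict c) i)) (lookup-restrict c i f)

  Glued : Pred (Fin (n H)) 0ℓ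
  Glued z = z ≡ src H e ⊎ z ≡ tgt H e

  module _ {c : Colouring G} where

    noBypass-restrict : NoBypass G c → ∀ i → NoBypass H (restrict c i)
    noBypass-restrict nb i f bypass =
      nb (ψ i f) (reorient (ψ-hom i f) (inj₁ (refl , refl)) (Walk-copy i recolour bypass))
      where
      recolour : ∀ {g} → Coloured (restrict c i) (not (lookup (restrict c i) f)) g →
        Coloured c (not (lookup c (ψ i f))) (ψ i g)
      recolour col = trans (sym (lookup-restrict c i _)) (trans col (cong not (lookup-restrict c i f)))

    module _ (restrictions-nb : ∀ j → NoBypass H (restrict c j)) (b : Bool) where

      Conn : Fin k → Rel (Fin (n H)) 0ℓ
      Conn j = Walk H (Coloured (restrict c j) b)

      e-ends-transfer : ∀ {j j′} → Conn j (src H e) (tgt H e) → Conn j′ (src H e) (tgt H e)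
      e-ends-transfer {j} {j′} w with lookup (restrict c j) e Bool.≟ b
      ... | yes e-b = Walk-edge e-b′ (inj₁ (refl , refl))
        where
        e-b′ : lookup (restrict c j′) e ≡ b
        e-b′ = trans (lookup-restrict c j′ e)
          (trans (cong (lookup c) (ψ-glue j′ j)) (trans (sym (lookup-restrict c j e)) e-b))
      ... | no e-¬b = ⊥-elim (restrictions-nb j e
        (Walk-map (λ col → trans col (¬-not (λ b≡ → e-¬b (sym b≡)))) (Walk-sym w)))

      Glued-transfer : ∀ {j j′ z z′} → Glued z → Glued z′ → Conn j z z′ → Conn j′ z z′
      Glued-transfer (inj₁ refl) (inj₁ refl) _ = ε
      Glued-transfer (inj₁ refl) (inj₂ refl) w = e-ends-transfer w
      Glued-transfer (inj₂ refl) (inj₁ refl) w = Walk-sym (e-ends-transfer (Walk-sym w))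
      Glued-transfer (inj₂ refl) (inj₂ refl) _ = ε

      Step-lift : ∀ {w w′} → Step G (Coloured c b) w w′ →
        ∃[ j ] ∃[ u ] ∃[ u′ ] φ j u ≡ w × φ j u′ ≡ w′ × Step H (Coloured (restrict c j) b) u u′
      Step-lift (step g col jg) with ψ-surj g
      ... | j , f , refl with Joins-unique G (ψ-hom j f) jg
      ...   | inj₁ (s , t) = j , src H f , tgt H f , s , t ,
        step f (trans (lookup-restrict c j f) col) (inj₁ (refl , refl))
      ...   | inj₂ (s , t) = j , tgt H f , src H f , t , s ,
        step f (trans (lookup-restrict c j f) col) (inj₂ (refl , refl))

      module _ (i : Fin k) (u₀ : Fin (n H)) where

        -- z is where the rerouted walk hands over from copy i to copy j.
        Reached : Pred (Fin (n G)) 0ℓ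
        Reached w = ∀ j u → φ j u ≡ w → ∃[ z ] Conn i u₀ z × Conn j z u × (j ≡ i ⊎ Glued z)

        Reached-start : Reached (φ i u₀)
        Reached-start j u φju≡ with φ-inj j i u u₀ φju≡
        ... | refl , j≡i-or-glued = u , ε , ε , j≡i-or-glued

        handoff : ∀ {j z u} → j ≡ i ⊎ Glued z → Glued u → Conn j z u → Conn i z u
        handoff (inj₁ refl) _ w = w
        handoff (inj₂ z-glued) u-glued w = Glued-transfer z-glued u-glued w

        Reached-step : ∀ {w w′} → Step G (Coloured c b) w w′ → Reached w → Reached w′
        Reached-step s reached j u φju≡ with Step-lift s
        ... | j′ , u₁ , u₂ , refl , refl , s′ with reached j′ u₁ refl | φ-inj j j′ u u₂ φju≡
        ...   | z , u₀⇝z , z⇝u₁ , z-ok | refl , inj₁ refl = z , u₀⇝z , z⇝u₁ ◅◅ s′ ◅ ε , z-ok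
        ...   | z , u₀⇝z , z⇝u₁ , z-ok | refl , inj₂ u-glued =
          u , u₀⇝z ◅◅ handoff z-ok u-glued (z⇝u₁ ◅◅ s′ ◅ ε) , ε , inj₂ u-glued

        Reached-walk : ∀ {w w′} → Walk G (Coloured c b) w w′ → Reached w → Reached w′
        Reached-walk ε reached = reached
        Reached-walk (s ◅ W) reached = Reached-walk W (Reached-step s reached)

        reroute : ∀ {v₀} → Walk G (Coloured c b) (φ i u₀) (φ i v₀) → Conn i u₀ v₀
        reroute {v₀} W with Reached-walk W Reached-start i v₀ refl
        ... | z , u₀⇝z , z⇝v₀ , _ = u₀⇝z ◅◅ z⇝v₀

    noBypass-glue : (∀ i → NoBypass H (restrict c i)) → NoBypass G c
    noBypass-glue restrictions-nb g bypass with ψ-surj g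
    ... | i , f , refl = restrictions-nb i f (Walk-map recolour
          (reroute restrictions-nb _ i (tgt H f) (reorient (inj₁ (refl , refl)) (ψ-hom i f) bypass)))
      where
      recolour : ∀ {g} → Coloured (restrict c i) (not (lookup c (ψ i f))) g →
        Coloured (restrict c i) (not (lookup (restrict c i) f)) g
      recolour col = trans col (cong not (sym (lookup-restrict c i f)))

  module _ (i₀ : Fin k) where

    Card-glue : ∀ {a} → Card (NoBypass H ∩ Red e) a → Card (NoBypass G ∩ Red (ψ i₀ e)) (a ^ k)
    Card-glue card = Card-image glue glue-injective into onto (Card-All card k)
      where
      restrict-glue-red : ∀ {ds} → VecAll.All (NoBypass H ∩ Red e) ds →
        ∀ i → restrict (glue ds) i ≡ lookup ds i
      restrict-glue-red {ds} ok =
        restrict-glue ds λ i j → trans (proj₂ (lookup⁺ ok i)) (sym (proj₂ (lookup⁺ ok j)))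
      glue-injective : ∀ {ds ds′} → VecAll.All (NoBypass H ∩ Red e) ds → VecAll.All (NoBypass H ∩ Red e) ds′ →
        glue ds ≡ glue ds′ → ds ≡ ds′
      glue-injective ok ok′ eq = lookup-extensionality λ i →
        trans (sym (restrict-glue-red ok i)) (trans (cong (λ c → restrict c i) eq) (restrict-glue-red ok′ i))
      into : ∀ ds → VecAll.All (NoBypass H ∩ Red e) ds → (NoBypass G ∩ Red (ψ i₀ e)) (glue ds)
      into ds ok =
        noBypass-glue {glue ds}
          (λ i → subst (NoBypass H) (sym (restrict-glue-red ok i)) (proj₁ (lookup⁺ ok i))) ,
        trans (sym (lookup-restrict (glue ds) i₀ e))
          (trans (cong (λ d → lookup d e) (restrict-glue-red ok i₀)) (proj₂ (lookup⁺ ok i₀)))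
      onto : ∀ c → (NoBypass G ∩ Red (ψ i₀ e)) c → ∃[ ds ] VecAll.All (NoBypass H ∩ Red e) ds × glue ds ≡ c
      onto c (nb , red) = tabulate (restrict c) ,
        tabulate⁺ (λ i → noBypass-restrict {c} nb i ,
                         trans (lookup-restrict c i e) (trans (cong (lookup c) (ψ-glue i i₀)) red)) ,
        glue-restrict c

    vertex-count : n G ∸ 2 ≡ k * (n H ∸ 2)
    vertex-count = Card-unique (Card-Fin-except-two X≢Y)
      (Card-image {P = U ⟨×⟩ Unglued} (uncurry φ) φ-injective into onto
        (Card-× (Card-Fin k) (Card-Fin-except-two (loopless H e))))
      where
      x y : Fin (n H)
      x = src H e
      y = tgt H e
      Unglued : Pred (Fin (n H)) 0ℓ
      Unglued u = u ≢ x × u ≢ y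
      X≢Y : φ i₀ x ≢ φ i₀ y
      X≢Y X≡Y = loopless H e (proj₁ (φ-inj i₀ i₀ x y X≡Y))
      φ-injective : ∀ {iu jv} → (U ⟨×⟩ Unglued) iu → (U ⟨×⟩ Unglued) jv →
        uncurry φ iu ≡ uncurry φ jv → iu ≡ jv
      φ-injective {i , u} {j , v} (_ , u≢x , u≢y) _ eq with φ-inj i j u v eq
      ... | refl , inj₁ refl = refl
      ... | refl , inj₂ (inj₁ u≡x) = ⊥-elim (u≢x u≡x)
      ... | refl , inj₂ (inj₂ u≡y) = ⊥-elim (u≢y u≡y)
      into : ∀ iu → (U ⟨×⟩ Unglued) iu → uncurry φ iu ≢ φ i₀ x × uncurry φ iu ≢ φ i₀ y
      into (i , u) (_ , u≢x , u≢y) =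
        (λ eq → u≢x (proj₁ (φ-inj i i₀ u x eq))) , (λ eq → u≢y (proj₁ (φ-inj i i₀ u y eq)))
      onto : ∀ w → w ≢ φ i₀ x × w ≢ φ i₀ y → ∃[ iu ] (U ⟨×⟩ Unglued) iu × uncurry φ iu ≡ w
      onto w (w≢X , w≢Y) with φ-surj w
      ... | i , u , refl = (i , u) ,
        (tt , (λ { refl → w≢X (φ-glue-src i i₀) }) , (λ { refl → w≢Y (φ-glue-tgt i i₀) })) , refl

complement : ∀ {l} → Vec Bool l → Vec Bool l
complement = Vec.map not

complement-involutive : ∀ {l} (c : Vec Bool l) → complement (complement c) ≡ c
complement-involutive c = trans (sym (map-∘ not not c)) (trans (map-cong not-involutive c) (map-id c))

complement-injective : ∀ {l} {c c′ : Vec Bool l} → complement c ≡ complement c′ → c ≡ c′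
complement-injective {c = c} {c′} eq =
  trans (sym (complement-involutive c)) (trans (cong complement eq) (complement-involutive c′))

allRed : ∀ l → Vec Bool l
allRed l = replicate l true

module _ {G : Graph} where

  noBypass-complement : ∀ {c} → NoBypass G c → NoBypass G (complement c)
  noBypass-complement {c} nb f bypass = nb f (Walk-map recolour bypass)
    where
    recolour : ∀ {g} → Coloured (complement c) (not (lookup (complement c) f)) g →
      Coloured c (not (lookup c f)) g
    recolour {g} col =
      not-injective (trans (sym (lookup-map g not c)) (trans col (cong not (lookup-map f not c))))

  IsNAC-complement : ∀ {c} → IsNAC G c → IsNAC G (complement c)
  IsNAC-complement {c} ((r , r-red) , (b , b-blue) , cc) =
    (b , trans (lookup-map b not c) (cong not b-blue)) , (r , trans (lookup-map r not c) (cong not r-red)) ,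
    noBypass⇒cycleCondition (complement c) (noBypass-complement {c = c} (cycleCondition⇒noBypass c cc))

  noBypass-allRed : NoBypass G (allRed (m G))
  noBypass-allRed f bypass = loopless G f (sym (Walk-empty no-blue bypass))
    where
    no-blue : ∀ {g} → ¬ Coloured (allRed (m G)) (not (lookup (allRed (m G)) f)) g
    no-blue {g} col = not-¬ refl
      (trans (sym (lookup-replicate g true)) (trans col (cong not (lookup-replicate f true))))

  module _ (e : Fin (m G)) where

    Card-NAC : ∀ {a} → Card (IsNAC G ∩ Red e) a → Card (IsNAC G) (2 * a)
    Card-NAC {a} reds = subst (Card (IsNAC G)) (cong (a +_) (sym (+-identityʳ a)))
      (Card-cong (λ _ → [ proj₁ , proj₁ ]) red-or-blue (Card-∪ not-red-and-blue reds blues))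
      where
      Blue : Pred (Colouring G) 0ℓ
      Blue c = lookup c e ≡ false
      red-or-blue : IsNAC G ⊆′ (IsNAC G ∩ Red e) ∪ (IsNAC G ∩ Blue)
      red-or-blue c nac with lookup c e
      ... | true = inj₁ (nac , refl)
      ... | false = inj₂ (nac , refl)
      not-red-and-blue : ∀ c → (IsNAC G ∩ Red e) c → (IsNAC G ∩ Blue) c → ⊥
      not-red-and-blue _ (_ , red) (_ , blue) = not-¬ refl (trans (sym red) blue)
      complement-red : ∀ c → (IsNAC G ∩ Red e) c → (IsNAC G ∩ Blue) (complement c)
      complement-red c (nac , red) = IsNAC-complement {c} nac , trans (lookup-map e not c) (cong not red)
      complement-blue : ∀ c → (IsNAC G ∩ Blue) c → ∃[ c′ ] (IsNAC G ∩ Red e) c′ × complement c′ ≡ c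
      complement-blue c (nac , blue) = complement c ,
        (IsNAC-complement {c} nac , trans (lookup-map e not c) (cong not blue)) , complement-involutive c
      blues : Card (IsNAC G ∩ Blue) a
      blues = Card-image complement (λ _ _ → complement-injective) complement-red complement-blue reds

    NAC≢allRed : ∀ {c} → IsNAC G c → c ≢ allRed (m G)
    NAC≢allRed (_ , (f , blue) , _) refl = not-¬ refl (trans (sym (lookup-replicate f true)) blue)

    redNoBypass⇒ : NoBypass G ∩ Red e ⊆′ (IsNAC G ∩ Red e) ∪ (_≡ allRed (m G))
    redNoBypass⇒ c (nb , red) with any? (λ f → lookup c f Bool.≟ false)
    ... | yes blue = inj₁ (((e , red) , blue , noBypass⇒cycleCondition c nb) , red)
    ... | no no-blue = inj₂ (lookup-extensionality λ f →
          trans (¬-not (λ blue → no-blue (f , blue))) (sym (lookup-replicate f true)))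

    redNoBypass⇐ : (IsNAC G ∩ Red e) ∪ (_≡ allRed (m G)) ⊆′ NoBypass G ∩ Red e
    redNoBypass⇐ c (inj₁ ((_ , _ , cc) , red)) = cycleCondition⇒noBypass c cc , red
    redNoBypass⇐ _ (inj₂ refl) = noBypass-allRed , lookup-replicate e true

    Card-redNoBypass : ∀ {a} → Card (IsNAC G ∩ Red e) a → Card (NoBypass G ∩ Red e) (a + 1)
    Card-redNoBypass reds = Card-cong redNoBypass⇐ redNoBypass⇒
      (Card-∪ (λ _ (nac , _) → NAC≢allRed nac) reds (Card-singleton (allRed (m G))))

    Card-redNAC : ∀ {b} → Card (NoBypass G ∩ Red e) b → Card (IsNAC G ∩ Red e) (b ∸ 1)
    Card-redNAC card =
      Card-cong to from (Card-remove (≡-dec Bool._≟_) (noBypass-allRed , lookup-replicate e true) card)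
      where
      to : (NoBypass G ∩ Red e) ∩ (_≢ allRed (m G)) ⊆′ IsNAC G ∩ Red e
      to c (red-nb , c≢allRed) = [ id , ⊥-elim ∘ c≢allRed ] (redNoBypass⇒ c red-nb)
      from : IsNAC G ∩ Red e ⊆′ (NoBypass G ∩ Red e) ∩ (_≢ allRed (m G))
      from c red-nac@(nac , _) = redNoBypass⇐ c (inj₁ red-nac) , NAC≢allRed nac

lemma5p4 : (H : Graph) (e : Fin (m H)) (k : ℕ) → 1 ≤ k →
    (G : Graph) → IsGluing H e k G →
    (N : ℕ) → NACCount H N →
    NACCount G (2 * ((N / 2 + 1) ^ k ∸ 1)) × (n G ∸ 2 ≡ k * (n H ∸ 2))
lemma5p4 H e k 1≤k G gl N nacs with Card-filter (λ c → lookup c e Bool.≟ true) nacs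
... | a , redNACs =
  subst (λ ν → NACCount G (2 * ((ν + 1) ^ k ∸ 1))) (sym N/2≡a)
    (Card-NAC (ψ i₀ e) (Card-redNAC (ψ i₀ e) (Card-glue i₀ (Card-redNoBypass e redNACs)))) ,
  vertex-count i₀
  where
  open Gluing gl
  open IsGluing gl using (ψ)
  i₀ : Fin k
  i₀ = fromℕ< 1≤k
  N/2≡a : N / 2 ≡ a
  N/2≡a = trans (cong (_/ 2) (trans (Card-unique nacs (Card-NAC e redNACs)) (*-comm 2 a))) (m*n/n≡m a 2)
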